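{- Let $G$ be a finite graph and $I$ an independent set of $G$. Then \[ |\mathcal{I}(G)| = 2^{|I|}\, Z_{\mathcal{P}(G,I)}, \] where $Z_{\mathcal{P}(G,I)} := \sum_{\mathcal{S}}\prod_{S\in\mathcal{S}} w(S)$, the sum ranging over all sets $\mathcal{S}$ (including the empty set) of pairwise compatible polymers of $\mathcal{P}(G,I)$.
   Context: $\mathcal{I}(G)$ is the set of independent sets of $G$. Write $\overline I := V(G)\setminus I$, $N_G(X) := \bigcup_{x\in X}N_G(x)\setminus X$ and $N_G(X,Y):=N_G(X)\cap Y$. A set $S\subseteq \overline I$ is $(2,I)$-linked if the induced subgraph $G[S\cup N_G(S,I)]$ is connected. A polymer of $\mathcal{P}(G,I)$ is a nonempty $(2,I)$-linked subset of $\overline I$ that is independent in $G$. Two polymers $S,T$ are compatible if $S\cup T$ is independent in $G$ but not $(2,I)$-linked. The weight of a polymer $S$ is $w(S) := 2^{ -|N_G(S,I)|}$. -}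

module Defs where

open import Data.Nat using (ℕ; zero; suc; _^_)
open import Data.Integer using (+_)
open import Data.Rational using (ℚ; 0ℚ; 1ℚ; ½; _+_; _*_; _/_)
open import Data.Bool using (Bool; true; false)
open import Data.Fin using (Fin)
open import Data.Fin.Subset using (Subset; _∈_; _∉_; _⊆_; _∪_; _∩_; ∁; Nonempty; ∣_∣; inside; outside; ⊥)
open import Data.Fin.Subset.Properties using (_∈?_; _⊆?_; nonempty?; anySubset?)
open import Data.Fin.Properties using (all?; any?)
open import Data.Vec using ([]; _∷_; tabulate)
open import Data.List using (List; []; _∷_; map; filter; length; _++_)
open import Data.List.Relation.Unary.AllPairs using (AllPairs)
open import Data.List.Relation.Unary.AllPairs.Properties using ()
open import Data.List.Relation.Unary.AllPairs using (allPairs?)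
open import Data.Product using (Σ; ∃; _×_; _,_)
open import Relation.Nullary using (¬_; Dec; yes; no)
open import Relation.Nullary.Decidable using (_×-dec_; _→-dec_; ¬?; ⌊_⌋)
open import Relation.Binary using (Rel; Decidable; Symmetric; Irreflexive)
open import Relation.Binary.PropositionalEquality using (_≡_)
open import Level using (0ℓ)

record Graph (n : ℕ) : Set₁ where
  field
    Adj    : Rel (Fin n) 0ℓ
    adj?   : Decidable Adj
    sym    : Symmetric Adj
    irrefl : ∀ {x} → ¬ Adj x x
open Graph public

module _ {n : ℕ} (G : Graph n) where

  Independent : Subset n → Set
  Independent X = ∀ x y → x ∈ X → y ∈ X → ¬ Adj G x y

  independent? : (X : Subset n) → Dec (Independent X)
  independent? X = all? λ x → all? λ y →
    (x ∈? X) →-dec ((y ∈? X) →-dec ¬? (adj? G x y))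

  N : Subset n → Subset n
  N X = tabulate λ v → ⌊ ¬? (v ∈? X) ×-dec any? (λ x → (x ∈? X) ×-dec adj? G x v) ⌋

  N₂ : Subset n → Subset n → Subset n
  N₂ X Y = N X ∩ Y

  Connected : Subset n → Set
  Connected X = ∀ A → A ⊆ X → Nonempty A →
    (∃ λ b → b ∈ X × b ∉ A) →
    ∃ λ a → ∃ λ b → a ∈ A × b ∈ X × b ∉ A × Adj G a b

  Linked : Subset n → Subset n → Set
  Linked I S = Connected (S ∪ N₂ S I)

  Polymer : Subset n → Subset n → Set
  Polymer I S = S ⊆ ∁ I × Nonempty S × Independent S × Linked I S

  Compatible : Subset n → Subset n → Subset n → Set
  Compatible I S T = Independent (S ∪ T) × ¬ Linked I (S ∪ T)

private
  ∀?⇒ : ∀ {n} {P : Subset n → Set} → (∀ X → Dec (P X)) → Dec (∀ X → P X)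
  ∀?⇒ {P = P} P? with anySubset? (λ X → ¬? (P? X))
  ... | yes (X , ¬p) = no λ h → ¬p (h X)
  ... | no ¬∃ = yes λ X → dec-stable (P? X) (λ ¬p → ¬∃ (X , ¬p))
    where
      open import Data.Empty using (⊥-elim)
      dec-stable : ∀ {A : Set} → Dec A → ¬ ¬ A → A
      dec-stable (yes a) _ = a
      dec-stable (no ¬a) nn = ⊥-elim (nn ¬a)

module _ {n : ℕ} (G : Graph n) where

  connected? : (X : Subset n) → Dec (Connected G X)
  connected? X = ∀?⇒ λ A → (A ⊆? X) →-dec (nonempty? A →-dec
    (any? (λ b → (b ∈? X) ×-dec ¬? (b ∈? A)) →-dec
     any? (λ a → any? (λ b → (a ∈? A) ×-dec ((b ∈? X) ×-dec (¬? (b ∈? A) ×-dec adj? G a b))))))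

  linked? : ∀ I S → Dec (Linked G I S)
  linked? I S = connected? (S ∪ N₂ G S I)

  polymer? : ∀ I S → Dec (Polymer G I S)
  polymer? I S = (S ⊆? ∁ I) ×-dec (nonempty? S ×-dec (independent? G S ×-dec linked? I S))

  compatible? : ∀ I S T → Dec (Compatible G I S T)
  compatible? I S T = independent? G (S ∪ T) ×-dec ¬? (linked? I (S ∪ T))

allSubsets : (n : ℕ) → List (Subset n)
allSubsets zero    = [] ∷ []
allSubsets (suc n) = map (inside ∷_) (allSubsets n) ++ map (outside ∷_) (allSubsets n)

-- all sublists (= all subsets, for a duplicate-free list)
sublists : ∀ {A : Set} → List A → List (List A)
sublists []       = [] ∷ []
sublists (x ∷ xs) = map (x ∷_) (sublists xs) ++ sublists xs

sumℚ : List ℚ → ℚ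
sumℚ []       = 0ℚ
sumℚ (q ∷ qs) = q + sumℚ qs

prodℚ : List ℚ → ℚ
prodℚ []       = 1ℚ
prodℚ (q ∷ qs) = q * prodℚ qs

halfPow : ℕ → ℚ
halfPow zero    = 1ℚ
halfPow (suc k) = ½ * halfPow k

ℕtoℚ : ℕ → ℚ
ℕtoℚ m = + m / 1

module _ {n : ℕ} (G : Graph n) where

  numIndependentSets : ℕ
  numIndependentSets = length (filter (independent? G) (allSubsets n))

  weight : Subset n → Subset n → ℚ
  weight I S = halfPow ∣ N₂ G S I ∣

  polymers : Subset n → List (Subset n)
  polymers I = filter (polymer? G I) (allSubsets n)

  compatibleFamilies : Subset n → List (List (Subset n))
  compatibleFamilies I = filter (allPairs? (compatible? G I)) (sublists (polymers I))

  Z : Subset n → ℚ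
  Z I = sumℚ (map (λ 𝒮 → prodℚ (map (weight I) 𝒮)) (compatibleFamilies I))

-- Split an independent set J of G into A = J ∖ I and J ∩ I. The sets A that occur are the
-- independent subsets of Ī, and over a fixed A the part J ∩ I ranges over all subsets of
-- I ∖ N(A, I); hence |I(G)| = Σ_A 2^(|I| - |N(A,I)|) = 2^|I| Σ_A 2^(-|N(A,I)|).
-- Each such A is the disjoint union of its (2,I)-linked components, which are pairwise
-- compatible polymers whose neighbourhoods in I are disjoint and cover N(A, I); conversely a
-- compatible family of polymers is the family of components of its union. So A ↦ (components
-- of A) is a bijection onto the compatible families with Π w(S) = 2^(-|N(A,I)|), and the sum
-- over A is Z_P(G,I).

module Submission where

open import Defs
open import Data.Nat using (ℕ; _^_)
open import Data.Fin.Subset using (Subset; ∣_∣)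
open import Data.Rational using (_*_)
open import Relation.Binary.PropositionalEquality using (_≡_)

open import Algebra.Bundles using (CommutativeMonoid)
open import Algebra.Properties.CommutativeSemigroup using (interchange)
open import Data.Bool using (true; false; if_then_else_)
import Data.Bool.Properties as Boolₚ
open import Data.Empty using (⊥-elim)
open import Data.Fin using (Fin)
open import Data.Fin.Properties using (all?; any?)
open import Data.Fin.Subset using (_∈_; _∉_; _⊆_; _∪_; _∩_; ∁; ⋃; ⁅_⁆; ⊥)
open import Data.Fin.Subset.Properties
open import Data.Integer as ℤ using (+_)
import Data.Integer.Properties as ℤₚ
open import Data.List using (List; []; _∷_; map; filter; length; _++_)
import Data.List.Properties as Listₚ
open import Data.List.Extrema.Nat using (argmax; argmax-all; f[xs]≤f[argmax])
open import Data.List.Membership.Propositional using () renaming (_∈_ to _∈ₗ_)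
open import Data.List.Membership.Propositional.Properties
  using (∈-map⁺; ∈-map⁻; ∈-++⁺ˡ; ∈-++⁺ʳ; ∈-++⁻; ∈-filter⁺; ∈-filter⁻)
open import Data.List.Membership.Propositional.Properties.WithK using (unique∧set⇒bag)
open import Data.List.Relation.Binary.BagAndSetEquality using (∼bag⇒↭)
open import Data.List.Relation.Binary.Permutation.Propositional as ↭ using (_↭_)
import Data.List.Relation.Binary.Permutation.Propositional.Properties as ↭ₚ
open import Data.List.Relation.Unary.All as All using (All; []; _∷_)
open import Data.List.Relation.Unary.All.Properties using (all-filter)
open import Data.List.Relation.Unary.AllPairs using (AllPairs; []; _∷_; allPairs?)
import Data.List.Relation.Unary.AllPairs.Properties as AllPairsₚ
open import Data.List.Relation.Unary.Any using (here; there)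
open import Data.List.Relation.Unary.Unique.Propositional using (Unique)
import Data.List.Relation.Unary.Unique.Propositional.Properties as Uniqueₚ
import Data.Nat as ℕ
open import Data.Nat.ListAction using (sum)
open import Data.Nat.ListAction.Properties using (sum-++)
import Data.Nat.Properties as ℕₚ
open import Data.Product using (∃; _×_; _,_; proj₁; proj₂)
import Data.Rational as ℚ
import Data.Rational.Properties as ℚₚ
open import Data.Rational.Unnormalised as ℚᵘ using (ℚᵘ; mkℚᵘ; *≡*)
import Data.Rational.Unnormalised.Properties as ℚᵘₚ
open import Data.Sum using (_⊎_; inj₁; inj₂; [_,_]′)
open import Data.Vec as Vec using ([]; _∷_)
import Data.Vec.Properties as Vecₚ
open import Function using (_∘_; id; _⇔_; mk⇔; Equivalence)
open import Level using (0ℓ)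
open import Relation.Binary using (Rel; Symmetric; DecidableEquality)
open import Relation.Binary.PropositionalEquality as ≡
  using (refl; trans; cong; cong₂; subst; _≢_)
open import Relation.Nullary using (¬_; Dec; yes; no; does)
open import Relation.Nullary.Decidable
  using (_×-dec_; _⊎-dec_; _→-dec_; ¬?; toWitness; fromWitness; decidable-stable)

𝟙 : ∀ {P : Set} → Dec P → ℕ
𝟙 p? = if does p? then 1 else 0

module _ {P : Set} where

  𝟙-yes : P → (p? : Dec P) → 𝟙 p? ≡ 1
  𝟙-yes _ (yes _) = refl
  𝟙-yes p (no ¬p) = ⊥-elim (¬p p)

  𝟙-no : ¬ P → (p? : Dec P) → 𝟙 p? ≡ 0
  𝟙-no ¬p (yes p) = ⊥-elim (¬p p)
  𝟙-no _  (no _)  = refl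

module _ {P Q : Set} where

  𝟙-cong : P ⇔ Q → (p? : Dec P) (q? : Dec Q) → 𝟙 p? ≡ 𝟙 q?
  𝟙-cong _   (yes _) (yes _) = refl
  𝟙-cong P⇔Q (yes p) (no ¬q) = ⊥-elim (¬q (Equivalence.to P⇔Q p))
  𝟙-cong P⇔Q (no ¬p) (yes q) = ⊥-elim (¬p (Equivalence.from P⇔Q q))
  𝟙-cong _   (no _)  (no _)  = refl

  𝟙-× : (p? : Dec P) (q? : Dec Q) → 𝟙 (p? ×-dec q?) ≡ 𝟙 p? ℕ.* 𝟙 q?
  𝟙-× (yes _) (yes _) = refl
  𝟙-× (yes _) (no _)  = refl
  𝟙-× (no _)  _       = refl

module _ {A : Set} where

  sum-map-zero : ∀ {f : A → ℕ} {xs} → All (λ x → f x ≡ 0) xs → sum (map f xs) ≡ 0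
  sum-map-zero []           = refl
  sum-map-zero (fx≡0 ∷ f≡0) = cong₂ ℕ._+_ fx≡0 (sum-map-zero f≡0)

  sum-map-+ : ∀ (f g : A → ℕ) xs →
              sum (map (λ x → f x ℕ.+ g x) xs) ≡ sum (map f xs) ℕ.+ sum (map g xs)
  sum-map-+ f g []       = refl
  sum-map-+ f g (x ∷ xs) = trans (cong (f x ℕ.+ g x ℕ.+_) (sum-map-+ f g xs))
    (interchange ℕₚ.+-commutativeSemigroup (f x) (g x) _ _)

  sum-map-*ˡ : ∀ c (f : A → ℕ) xs → sum (map (λ x → c ℕ.* f x) xs) ≡ c ℕ.* sum (map f xs)
  sum-map-*ˡ c f []       = ≡.sym (ℕₚ.*-zeroʳ c)
  sum-map-*ˡ c f (x ∷ xs) = trans (cong (c ℕ.* f x ℕ.+_) (sum-map-*ˡ c f xs))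
    (≡.sym (ℕₚ.*-distribˡ-+ c (f x) _))

  sum-map-++ : ∀ (f : A → ℕ) xs ys → sum (map f (xs ++ ys)) ≡ sum (map f xs) ℕ.+ sum (map f ys)
  sum-map-++ f xs ys = trans (cong sum (Listₚ.map-++ f xs ys)) (sum-++ (map f xs) (map f ys))

  module _ {P : A → Set} (P? : ∀ x → Dec (P x)) where

    length-filter : ∀ xs → length (filter P? xs) ≡ sum (map (𝟙 ∘ P?) xs)
    length-filter []       = refl
    length-filter (x ∷ xs) with P? x
    ... | yes _ = cong ℕ.suc (length-filter xs)
    ... | no _  = length-filter xs

    sum-map-filter : ∀ (f : A → ℕ) xs →
                     sum (map f (filter P? xs)) ≡ sum (map (λ x → 𝟙 (P? x) ℕ.* f x) xs)
    sum-map-filter f []       = refl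
    sum-map-filter f (x ∷ xs) with P? x
    ... | yes _ = cong₂ ℕ._+_ (≡.sym (ℕₚ.+-identityʳ (f x))) (sum-map-filter f xs)
    ... | no _  = sum-map-filter f xs

  sum-𝟙-≟ : (_≟_ : DecidableEquality A) → ∀ {x xs} → Unique xs → x ∈ₗ xs →
            sum (map (λ y → 𝟙 (x ≟ y)) xs) ≡ 1
  sum-𝟙-≟ _≟_ {x} (x≢ys ∷ _) (here refl) =
    cong₂ ℕ._+_ (𝟙-yes refl (x ≟ x)) (sum-map-zero (All.map (λ x≢y → 𝟙-no x≢y (x ≟ _)) x≢ys))
  sum-𝟙-≟ _≟_ {x} {y ∷ _} (y≢ys ∷ u) (there x∈ys) =
    cong₂ ℕ._+_ (𝟙-no (λ x≡y → All.lookup y≢ys x∈ys (≡.sym x≡y)) (x ≟ y)) (sum-𝟙-≟ _≟_ u x∈ys)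

sum-map-swap : ∀ {A B : Set} (t : A → B → ℕ) xs ys →
               sum (map (λ x → sum (map (t x) ys)) xs) ≡
               sum (map (λ y → sum (map (λ x → t x y) xs)) ys)
sum-map-swap t []       ys = ≡.sym (sum-map-zero (All.universal (λ _ → refl) ys))
sum-map-swap t (x ∷ xs) ys = trans (cong (sum (map (t x) ys) ℕ.+_) (sum-map-swap t xs ys))
  (≡.sym (sum-map-+ (t x) _ ys))

module _ {A : Set} where

  Unique⇒AllPairs : ∀ {R : Rel A 0ℓ} {xs} → Unique xs →
                    (∀ {x y} → x ∈ₗ xs → y ∈ₗ xs → x ≢ y → R x y) → AllPairs R xs
  Unique⇒AllPairs []         _ = []
  Unique⇒AllPairs (x≢ys ∷ u) R-distinct =
    All.tabulate (λ y∈ys → R-distinct (here refl) (there y∈ys) (All.lookup x≢ys y∈ys))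
    ∷ Unique⇒AllPairs u (λ x∈ y∈ → R-distinct (there x∈) (there y∈))

  AllPairs-∈ : ∀ {R : Rel A 0ℓ} {xs x y} → Symmetric R → AllPairs R xs →
               x ∈ₗ xs → y ∈ₗ xs → x ≡ y ⊎ R x y
  AllPairs-∈ _     (_ ∷ _)    (here refl) (here refl) = inj₁ refl
  AllPairs-∈ _     (Rx ∷ _)   (here refl) (there y∈)  = inj₂ (All.lookup Rx y∈)
  AllPairs-∈ R-sym (Ry ∷ _)   (there x∈)  (here refl) = inj₂ (R-sym (All.lookup Ry x∈))
  AllPairs-∈ R-sym (_ ∷ R-xs) (there x∈)  (there y∈)  = AllPairs-∈ R-sym R-xs x∈ y∈

  unique∧sameMembers⇒↭ : ∀ {xs ys : List A} → Unique xs → Unique ys →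
                         (∀ {x} → x ∈ₗ xs → x ∈ₗ ys) → (∀ {x} → x ∈ₗ ys → x ∈ₗ xs) → xs ↭ ys
  unique∧sameMembers⇒↭ u v xs⊆ys ys⊆xs = ∼bag⇒↭ (unique∧set⇒bag u v (mk⇔ xs⊆ys ys⊆xs))

  ∈-sublists⁻ : ∀ {xs ys : List A} {x} → ys ∈ₗ sublists xs → x ∈ₗ ys → x ∈ₗ xs
  ∈-sublists⁻ {[]} (here refl) ()
  ∈-sublists⁻ {y ∷ xs} ys∈ x∈ys with ∈-++⁻ (map (y ∷_) (sublists xs)) ys∈
  ... | inj₂ ys∈′ = there (∈-sublists⁻ ys∈′ x∈ys)
  ... | inj₁ ys∈′ with ∈-map⁻ (y ∷_) ys∈′ | x∈ys
  ...   | zs , _ , refl | here refl = here refl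
  ...   | zs , zs∈ , refl | there x∈zs = there (∈-sublists⁻ zs∈ x∈zs)

  sublists-unique : ∀ {xs : List A} → Unique xs → Unique (sublists xs)
  sublists-unique {[]}     _          = [] ∷ []
  sublists-unique {x ∷ xs} (x∉xs ∷ u) =
    Uniqueₚ.++⁺ (Uniqueₚ.map⁺ ∷-injective (sublists-unique u)) (sublists-unique u) disjoint
    where
    ∷-injective : ∀ {ys zs : List A} → x ∷ ys ≡ x ∷ zs → ys ≡ zs
    ∷-injective refl = refl
    disjoint : ∀ {ys} → ¬ (ys ∈ₗ map (x ∷_) (sublists xs) × ys ∈ₗ sublists xs)
    disjoint (ys∈ , ys∈′) with ∈-map⁻ (x ∷_) ys∈
    ... | _ , _ , refl = All.lookup x∉xs (∈-sublists⁻ ys∈′ (here refl)) refl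

  module _ {P : A → Set} (P? : ∀ x → Dec (P x)) where

    filter∈sublists : ∀ xs → filter P? xs ∈ₗ sublists xs
    filter∈sublists []       = here refl
    filter∈sublists (x ∷ xs) with P? x
    ... | yes _ = ∈-++⁺ˡ (∈-map⁺ (x ∷_) (filter∈sublists xs))
    ... | no _  = ∈-++⁺ʳ (map (x ∷_) (sublists xs)) (filter∈sublists xs)

    ∈-sublists⇒≡filter : ∀ {xs ys} → Unique xs → ys ∈ₗ sublists xs →
                         (∀ {x} → x ∈ₗ xs → x ∈ₗ ys → P x) → (∀ {x} → x ∈ₗ xs → P x → x ∈ₗ ys) →
                         ys ≡ filter P? xs
    ∈-sublists⇒≡filter {[]} _ (here refl) _ _ = refl
    ∈-sublists⇒≡filter {x ∷ xs} (x∉xs ∷ u) ys∈ sound complete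
      with P? x | ∈-++⁻ (map (x ∷_) (sublists xs)) ys∈
    ... | yes _  | inj₁ ys∈′ with ∈-map⁻ (x ∷_) ys∈′
    ...   | zs , zs∈ , refl = cong (x ∷_) (∈-sublists⇒≡filter u zs∈
            (λ y∈xs y∈zs → sound (there y∈xs) (there y∈zs)) complete′)
      where
      complete′ : ∀ {y} → y ∈ₗ xs → P y → y ∈ₗ zs
      complete′ y∈xs Py with complete (there y∈xs) Py
      ... | here refl = ⊥-elim (All.lookup x∉xs y∈xs refl)
      ... | there y∈zs = y∈zs
    ∈-sublists⇒≡filter {x ∷ xs} _ _ sound _ | no ¬Px | inj₁ ys∈′ with ∈-map⁻ (x ∷_) ys∈′
    ...   | _ , _ , refl = ⊥-elim (¬Px (sound (here refl) (here refl)))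
    ∈-sublists⇒≡filter {x ∷ xs} (x∉xs ∷ _) _ _ complete | yes Px | inj₂ ys∈′ =
      ⊥-elim (All.lookup x∉xs (∈-sublists⁻ ys∈′ (complete (here refl) Px)) refl)
    ∈-sublists⇒≡filter {x ∷ xs} (_ ∷ u) _ sound complete | no _ | inj₂ ys∈′ =
      ∈-sublists⇒≡filter u ys∈′ (λ y∈xs → sound (there y∈xs)) (λ y∈xs → complete (there y∈xs))

∈-allSubsets : ∀ {n} (X : Subset n) → X ∈ₗ allSubsets n
∈-allSubsets []           = here refl
∈-allSubsets {ℕ.suc n} (true ∷ X) = ∈-++⁺ˡ (∈-map⁺ (true ∷_) (∈-allSubsets X))
∈-allSubsets {ℕ.suc n} (false ∷ X) =
  ∈-++⁺ʳ (map (true ∷_) (allSubsets n)) (∈-map⁺ (false ∷_) (∈-allSubsets X))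

allSubsets-unique : ∀ n → Unique (allSubsets n)
allSubsets-unique ℕ.zero    = [] ∷ []
allSubsets-unique (ℕ.suc n) =
  Uniqueₚ.++⁺ (Uniqueₚ.map⁺ ∷-injective (allSubsets-unique n))
              (Uniqueₚ.map⁺ ∷-injective (allSubsets-unique n)) disjoint
  where
  ∷-injective : ∀ {b} {X Y : Subset n} → b ∷ X ≡ b ∷ Y → X ≡ Y
  ∷-injective refl = refl
  disjoint : ∀ {X} → ¬ (X ∈ₗ map (true ∷_) (allSubsets n) × X ∈ₗ map (false ∷_) (allSubsets n))
  disjoint (X∈ , X∈′) with ∈-map⁻ (true ∷_) X∈ | ∈-map⁻ (false ∷_) X∈′
  ... | _ , _ , refl | _ , _ , ()

sum-map-allSubsets : ∀ {n} (f : Subset (ℕ.suc n) → ℕ) →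
  sum (map f (allSubsets (ℕ.suc n))) ≡
  sum (map (f ∘ (true ∷_)) (allSubsets n)) ℕ.+ sum (map (f ∘ (false ∷_)) (allSubsets n))
sum-map-allSubsets {n} f =
  trans (sum-map-++ f (map (true ∷_) (allSubsets n)) (map (false ∷_) (allSubsets n)))
        (cong₂ ℕ._+_ (cong sum (≡.sym (Listₚ.map-∘ (allSubsets n))))
                     (cong sum (≡.sym (Listₚ.map-∘ (allSubsets n)))))

sumℚ-↭ : ∀ {xs ys} → xs ↭ ys → sumℚ xs ≡ sumℚ ys
sumℚ-↭ ↭.refl            = refl
sumℚ-↭ (↭.prep x p)      = cong (x ℚ.+_) (sumℚ-↭ p)
sumℚ-↭ {x ∷ y ∷ xs} {_ ∷ _ ∷ ys} (↭.swap _ _ p) =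
  trans (≡.sym (ℚₚ.+-assoc x y (sumℚ xs)))
        (trans (cong₂ ℚ._+_ (ℚₚ.+-comm x y) (sumℚ-↭ p)) (ℚₚ.+-assoc y x (sumℚ ys)))
sumℚ-↭ (↭.trans p q)     = trans (sumℚ-↭ p) (sumℚ-↭ q)

*-sumℚ : ∀ {A : Set} c (f : A → ℚ.ℚ) xs → c * sumℚ (map f xs) ≡ sumℚ (map (λ x → c * f x) xs)
*-sumℚ c f []       = ℚₚ.*-zeroʳ c
*-sumℚ c f (x ∷ xs) = trans (ℚₚ.*-distribˡ-+ c (f x) _) (cong (c * f x ℚ.+_) (*-sumℚ c f xs))

private
  ℕtoℚᵘ : ℕ → ℚᵘ
  ℕtoℚᵘ m = mkℚᵘ (+ m) 0

  -- ℕtoℚ m unfolds to fromℚᵘ (ℕtoℚᵘ m).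
  toℚᵘ-ℕtoℚ : ∀ m → ℚ.toℚᵘ (ℕtoℚ m) ℚᵘ.≃ ℕtoℚᵘ m
  toℚᵘ-ℕtoℚ m = ℚₚ.toℚᵘ-fromℚᵘ (ℕtoℚᵘ m)

ℕtoℚ-+ : ∀ a b → ℕtoℚ (a ℕ.+ b) ≡ ℕtoℚ a ℚ.+ ℕtoℚ b
ℕtoℚ-+ a b = ℚₚ.toℚᵘ-injective (begin
  ℚ.toℚᵘ (ℕtoℚ (a ℕ.+ b))                  ≈⟨ toℚᵘ-ℕtoℚ (a ℕ.+ b) ⟩
  ℕtoℚᵘ (a ℕ.+ b)                          ≈⟨ *≡* (cong (ℤ._* + 1) +-homo) ⟩
  ℕtoℚᵘ a ℚᵘ.+ ℕtoℚᵘ b                     ≈⟨ ℚᵘₚ.+-cong (toℚᵘ-ℕtoℚ a) (toℚᵘ-ℕtoℚ b) ⟨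
  ℚ.toℚᵘ (ℕtoℚ a) ℚᵘ.+ ℚ.toℚᵘ (ℕtoℚ b)     ≈⟨ ℚₚ.toℚᵘ-homo-+ (ℕtoℚ a) (ℕtoℚ b) ⟨
  ℚ.toℚᵘ (ℕtoℚ a ℚ.+ ℕtoℚ b)               ∎)
  where
  open ℚᵘₚ.≃-Reasoning
  +-homo : + (a ℕ.+ b) ≡ + a ℤ.* + 1 ℤ.+ + b ℤ.* + 1
  +-homo = trans (ℤₚ.pos-+ a b) (≡.sym (cong₂ ℤ._+_ (ℤₚ.*-identityʳ (+ a)) (ℤₚ.*-identityʳ (+ b))))

ℕtoℚ-* : ∀ a b → ℕtoℚ (a ℕ.* b) ≡ ℕtoℚ a * ℕtoℚ b
ℕtoℚ-* a b = ℚₚ.toℚᵘ-injective (begin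
  ℚ.toℚᵘ (ℕtoℚ (a ℕ.* b))                  ≈⟨ toℚᵘ-ℕtoℚ (a ℕ.* b) ⟩
  ℕtoℚᵘ (a ℕ.* b)                          ≈⟨ *≡* (cong (ℤ._* + 1) (ℤₚ.pos-* a b)) ⟩
  ℕtoℚᵘ a ℚᵘ.* ℕtoℚᵘ b                     ≈⟨ ℚᵘₚ.*-cong (toℚᵘ-ℕtoℚ a) (toℚᵘ-ℕtoℚ b) ⟨
  ℚ.toℚᵘ (ℕtoℚ a) ℚᵘ.* ℚ.toℚᵘ (ℕtoℚ b)     ≈⟨ ℚₚ.toℚᵘ-homo-* (ℕtoℚ a) (ℕtoℚ b) ⟨
  ℚ.toℚᵘ (ℕtoℚ a * ℕtoℚ b)                 ∎)
  where open ℚᵘₚ.≃-Reasoning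

ℕtoℚ-sum : ∀ {A : Set} (f : A → ℕ) xs → ℕtoℚ (sum (map f xs)) ≡ sumℚ (map (ℕtoℚ ∘ f) xs)
ℕtoℚ-sum f []       = refl
ℕtoℚ-sum f (x ∷ xs) = trans (ℕtoℚ-+ (f x) _) (cong (ℕtoℚ (f x) ℚ.+_) (ℕtoℚ-sum f xs))

halfPow-+ : ∀ a b → halfPow (a ℕ.+ b) ≡ halfPow a * halfPow b
halfPow-+ ℕ.zero    b = ≡.sym (ℚₚ.*-identityˡ (halfPow b))
halfPow-+ (ℕ.suc a) b =
  trans (cong (ℚ.½ *_) (halfPow-+ a b)) (≡.sym (ℚₚ.*-assoc ℚ.½ (halfPow a) (halfPow b)))

2^*halfPow : ∀ k → ℕtoℚ (2 ^ k) * halfPow k ≡ ℚ.1ℚ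
2^*halfPow ℕ.zero    = refl
2^*halfPow (ℕ.suc k) = begin
  ℕtoℚ (2 ℕ.* 2 ^ k) * (ℚ.½ * halfPow k)
    ≡⟨ cong (_* (ℚ.½ * halfPow k)) (ℕtoℚ-* 2 (2 ^ k)) ⟩
  (ℕtoℚ 2 * ℕtoℚ (2 ^ k)) * (ℚ.½ * halfPow k)
    ≡⟨ *-interchange (ℕtoℚ 2) (ℕtoℚ (2 ^ k)) ℚ.½ (halfPow k) ⟩
  (ℕtoℚ 2 * ℚ.½) * (ℕtoℚ (2 ^ k) * halfPow k)
    ≡⟨ cong (ℚ.1ℚ *_) (2^*halfPow k) ⟩
  ℚ.1ℚ * ℚ.1ℚ  ∎
  where
  open ≡.≡-Reasoning
  *-interchange : ∀ a b c d → (a * b) * (c * d) ≡ (a * c) * (b * d)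
  *-interchange = interchange (CommutativeMonoid.commutativeSemigroup ℚₚ.*-1-commutativeMonoid)

2^-+*halfPow : ∀ a b → ℕtoℚ (2 ^ (a ℕ.+ b)) * halfPow b ≡ ℕtoℚ (2 ^ a)
2^-+*halfPow a b = begin
  ℕtoℚ (2 ^ (a ℕ.+ b)) * halfPow b
    ≡⟨ cong (λ m → ℕtoℚ m * halfPow b) (ℕₚ.^-distribˡ-+-* 2 a b) ⟩
  ℕtoℚ (2 ^ a ℕ.* 2 ^ b) * halfPow b
    ≡⟨ cong (_* halfPow b) (ℕtoℚ-* (2 ^ a) (2 ^ b)) ⟩
  (ℕtoℚ (2 ^ a) * ℕtoℚ (2 ^ b)) * halfPow b
    ≡⟨ ℚₚ.*-assoc (ℕtoℚ (2 ^ a)) _ _ ⟩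
  ℕtoℚ (2 ^ a) * (ℕtoℚ (2 ^ b) * halfPow b)
    ≡⟨ cong (ℕtoℚ (2 ^ a) *_) (2^*halfPow b) ⟩
  ℕtoℚ (2 ^ a) * ℚ.1ℚ
    ≡⟨ ℚₚ.*-identityʳ _ ⟩
  ℕtoℚ (2 ^ a)  ∎
  where open ≡.≡-Reasoning

module _ {n : ℕ} where

  ∪-⊆ : ∀ {p q r : Subset n} → p ⊆ r → q ⊆ r → p ∪ q ⊆ r
  ∪-⊆ {p} {q} p⊆r q⊆r x∈ = [ p⊆r , q⊆r ]′ (x∈p∪q⁻ p q x∈)

  x∈p⇒⁅x⁆⊆p : ∀ {x} {p : Subset n} → x ∈ p → ⁅ x ⁆ ⊆ p
  x∈p⇒⁅x⁆⊆p {x} {p} x∈p y∈⁅x⁆ = subst (_∈ p) (≡.sym (x∈⁅y⁆⇒x≡y x y∈⁅x⁆)) x∈p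

  ∈⁅y⁆∪q⇒∈q : ∀ {x y} {q : Subset n} → x ∈ ⁅ y ⁆ ∪ q → x ≢ y → x ∈ q
  ∈⁅y⁆∪q⇒∈q {y = y} {q} x∈ x≢y =
    [ (λ x∈⁅y⁆ → ⊥-elim (x≢y (x∈⁅y⁆⇒x≡y y x∈⁅y⁆))) , (λ x∈q → x∈q) ]′ (x∈p∪q⁻ ⁅ y ⁆ q x∈)

  ∈⋃⁻ : ∀ {x} (Ss : List (Subset n)) → x ∈ ⋃ Ss → ∃ λ S → S ∈ₗ Ss × x ∈ S
  ∈⋃⁻ []       x∈ = ⊥-elim (∉⊥ x∈)
  ∈⋃⁻ (S ∷ Ss) x∈ with x∈p∪q⁻ S (⋃ Ss) x∈
  ... | inj₁ x∈S  = S , here refl , x∈S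
  ... | inj₂ x∈Ss with ∈⋃⁻ Ss x∈Ss
  ...   | T , T∈ , x∈T = T , there T∈ , x∈T

  ∈⋃⁺ : ∀ {x S} {Ss : List (Subset n)} → S ∈ₗ Ss → x ∈ S → x ∈ ⋃ Ss
  ∈⋃⁺ (here refl) x∈S = x∈p∪q⁺ (inj₁ x∈S)
  ∈⋃⁺ (there S∈)  x∈S = x∈p∪q⁺ (inj₂ (∈⋃⁺ S∈ x∈S))

  ⋃-⊆ : ∀ {T} (Ss : List (Subset n)) → (∀ {S} → S ∈ₗ Ss → S ⊆ T) → ⋃ Ss ⊆ T
  ⋃-⊆ Ss Ss⊆T x∈ with ∈⋃⁻ Ss x∈
  ... | S , S∈ , x∈S = Ss⊆T S∈ x∈S

∣p∪q∣≡∣p∣+∣q∣ : ∀ {n} (p q : Subset n) → (∀ {x} → x ∈ p → x ∉ q) → ∣ p ∪ q ∣ ≡ ∣ p ∣ ℕ.+ ∣ q ∣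
∣p∪q∣≡∣p∣+∣q∣ []          []          _ = refl
∣p∪q∣≡∣p∣+∣q∣ (true ∷ p)  (true ∷ q)  disjoint = ⊥-elim (disjoint Vec.here Vec.here)
∣p∪q∣≡∣p∣+∣q∣ (true ∷ p)  (false ∷ q) disjoint =
  cong ℕ.suc (∣p∪q∣≡∣p∣+∣q∣ p q (λ x∈p x∈q → disjoint (Vec.there x∈p) (Vec.there x∈q)))
∣p∪q∣≡∣p∣+∣q∣ (false ∷ p) (true ∷ q)  disjoint =
  trans (cong ℕ.suc (∣p∪q∣≡∣p∣+∣q∣ p q (λ x∈p x∈q → disjoint (Vec.there x∈p) (Vec.there x∈q))))
        (≡.sym (ℕₚ.+-suc ∣ p ∣ ∣ q ∣))
∣p∪q∣≡∣p∣+∣q∣ (false ∷ p) (false ∷ q) disjoint =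
  ∣p∪q∣≡∣p∣+∣q∣ p q (λ x∈p x∈q → disjoint (Vec.there x∈p) (Vec.there x∈q))

∣p∣≡∣p∩∁q∣+∣q∣ : ∀ {n} (p q : Subset n) → q ⊆ p → ∣ p ∣ ≡ ∣ p ∩ ∁ q ∣ ℕ.+ ∣ q ∣
∣p∣≡∣p∩∁q∣+∣q∣ []          []          _   = refl
∣p∣≡∣p∩∁q∣+∣q∣ (true ∷ p)  (true ∷ q)  q⊆p =
  trans (cong ℕ.suc (∣p∣≡∣p∩∁q∣+∣q∣ p q (drop-∷-⊆ q⊆p))) (≡.sym (ℕₚ.+-suc ∣ p ∩ ∁ q ∣ ∣ q ∣))
∣p∣≡∣p∩∁q∣+∣q∣ (true ∷ p)  (false ∷ q) q⊆p = cong ℕ.suc (∣p∣≡∣p∩∁q∣+∣q∣ p q (drop-∷-⊆ q⊆p))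
∣p∣≡∣p∩∁q∣+∣q∣ (false ∷ p) (true ∷ q)  q⊆p with q⊆p Vec.here
... | ()
∣p∣≡∣p∩∁q∣+∣q∣ (false ∷ p) (false ∷ q) q⊆p = ∣p∣≡∣p∩∁q∣+∣q∣ p q (drop-∷-⊆ q⊆p)

module _ {n : ℕ} where

  infix 4 _≟ₛ_
  _≟ₛ_ : DecidableEquality (Subset n)
  _≟ₛ_ = Vecₚ.≡-dec Boolₚ._≟_

  AgreeOutside : Subset n → Subset n → Subset n → Set
  AgreeOutside F X Y = X ∩ ∁ F ≡ Y ∩ ∁ F

  agreeOutside? : ∀ F X Y → Dec (AgreeOutside F X Y)
  agreeOutside? F X Y = X ∩ ∁ F ≟ₛ Y ∩ ∁ F

  agreeOutside⁺ : ∀ {F X Y} → (∀ {x} → x ∉ F → x ∈ X → x ∈ Y) → (∀ {x} → x ∉ F → x ∈ Y → x ∈ X) →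
                  AgreeOutside F X Y
  agreeOutside⁺ {F} {X} {Y} X⊆Y Y⊆X = ⊆-antisym (restrict X⊆Y) (restrict Y⊆X)
    where
    restrict : ∀ {U V} → (∀ {x} → x ∉ F → x ∈ U → x ∈ V) → U ∩ ∁ F ⊆ V ∩ ∁ F
    restrict {U} U⊆V x∈ with x∈p∩q⁻ U (∁ F) x∈
    ... | x∈U , x∈∁F = x∈p∩q⁺ (U⊆V (x∈∁p⇒x∉p x∈∁F) x∈U , x∈∁F)

  agreeOutside⁻ : ∀ {F X Y x} → AgreeOutside F X Y → x ∉ F → x ∈ X → x ∈ Y
  agreeOutside⁻ {F} {X} {Y} X≈Y x∉F x∈X =
    p∩q⊆p Y (∁ F) (subst (_ ∈_) X≈Y (x∈p∩q⁺ (x∈X , x∉p⇒x∈∁p x∉F)))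

private
  a≡b⇒a+a≡2*b : ∀ {a b} → a ≡ b → a ℕ.+ a ≡ 2 ℕ.* b
  a≡b⇒a+a≡2*b {b = b} a≡b = cong₂ ℕ._+_ a≡b (trans a≡b (≡.sym (ℕₚ.+-identityʳ b)))

  sum-zeros : ∀ n → sum (map (λ (_ : Subset n) → 0) (allSubsets n)) ≡ 0
  sum-zeros n = sum-map-zero (All.universal (λ _ → refl) (allSubsets n))

count-agreeOutside : ∀ {n} (F X : Subset n) →
                     sum (map (λ Y → 𝟙 (agreeOutside? F Y X)) (allSubsets n)) ≡ 2 ^ ∣ F ∣
count-agreeOutside []          []          = refl
count-agreeOutside F′@(true ∷ F)  X′@(true ∷ X)  =
  trans (sum-map-allSubsets (λ Y → 𝟙 (agreeOutside? F′ Y X′)))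
        (a≡b⇒a+a≡2*b (count-agreeOutside F X))
count-agreeOutside F′@(true ∷ F)  X′@(false ∷ X) =
  trans (sum-map-allSubsets (λ Y → 𝟙 (agreeOutside? F′ Y X′)))
        (a≡b⇒a+a≡2*b (count-agreeOutside F X))
count-agreeOutside {ℕ.suc n} F′@(false ∷ F) X′@(true ∷ X)  =
  trans (sum-map-allSubsets (λ Y → 𝟙 (agreeOutside? F′ Y X′)))
        (trans (cong₂ ℕ._+_ (count-agreeOutside F X) (sum-zeros n)) (ℕₚ.+-identityʳ _))
count-agreeOutside {ℕ.suc n} F′@(false ∷ F) X′@(false ∷ X) =
  trans (sum-map-allSubsets (λ Y → 𝟙 (agreeOutside? F′ Y X′)))
        (cong₂ ℕ._+_ (sum-zeros n) (count-agreeOutside F X))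

module _ {n : ℕ} (G : Graph n) where

  private
    N? : ∀ X v → Dec (v ∉ X × ∃ λ x → x ∈ X × Adj G x v)
    N? X v = ¬? (v ∈? X) ×-dec any? (λ x → (x ∈? X) ×-dec adj? G x v)

  ∈N⁻ : ∀ {X v} → v ∈ N G X → v ∉ X × ∃ λ x → x ∈ X × Adj G x v
  ∈N⁻ {X} {v} v∈ = toWitness {a? = N? X v} (Equivalence.from Boolₚ.T-≡
    (trans (≡.sym (Vecₚ.lookup∘tabulate _ v)) (Vecₚ.[]=⇒lookup v∈)))

  ∈N⁺ : ∀ {X v x} → v ∉ X → x ∈ X → Adj G x v → v ∈ N G X
  ∈N⁺ {X} {v} v∉X x∈X x~v = Vecₚ.lookup⇒[]= v (N G X)
    (trans (Vecₚ.lookup∘tabulate _ v)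
           (Equivalence.to Boolₚ.T-≡ (fromWitness {a? = N? X v} (v∉X , _ , x∈X , x~v))))

  IndependentIn : Subset n → Subset n → Set
  IndependentIn U A = A ⊆ U × Independent G A

  independentIn? : ∀ U A → Dec (IndependentIn U A)
  independentIn? U A = (A ⊆? U) ×-dec independent? G A

  independent-⊆ : ∀ {A B} → A ⊆ B → Independent G B → Independent G A
  independent-⊆ A⊆B B-indep x y x∈A y∈A = B-indep x y (A⊆B x∈A) (A⊆B y∈A)

  Crossing : Subset n → Subset n → Set
  Crossing B U = ∃ λ a → ∃ λ b → a ∈ B × b ∈ U × b ∉ B × Adj G a b

  crossing-⊆ : ∀ {B U V} → U ⊆ V → Crossing B U → Crossing B V
  crossing-⊆ U⊆V (a , b , a∈B , b∈U , b∉B , a~b) = a , b , a∈B , U⊆V b∈U , b∉B , a~b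

  connected-split : ∀ {X} → Connected G X → ∀ B →
                    Crossing B X ⊎ X ⊆ B ⊎ (∀ {x} → x ∈ X → x ∉ B)
  connected-split {X} X-conn B
    with any? (λ x → (x ∈? X) ×-dec ¬? (x ∈? B)) | any? (λ x → (x ∈? X) ×-dec (x ∈? B))
  ... | yes (b , b∈X , b∉B) | yes (a , a∈X , a∈B) = inj₁ (crossing-∩ (X-conn (B ∩ X) (p∩q⊆q B X)
        (a , x∈p∩q⁺ (a∈B , a∈X)) (b , b∈X , λ b∈B∩X → b∉B (p∩q⊆p B X b∈B∩X))))
    where
    crossing-∩ : Crossing (B ∩ X) X → Crossing B X
    crossing-∩ (a , b , a∈ , b∈X , b∉ , a~b) =
      a , b , p∩q⊆p B X a∈ , b∈X , (λ b∈B → b∉ (x∈p∩q⁺ (b∈B , b∈X))) , a~b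
  ... | no ∄b | _ = inj₂ (inj₁ λ {x} x∈X → decidable-stable (x ∈? B) λ x∉B → ∄b (x , x∈X , x∉B))
  ... | yes _ | no ∄a = inj₂ (inj₂ λ {x} x∈X x∈B → ∄a (x , x∈X , x∈B))

  private
    adjacent-across : ∀ {B x y} → x ∈ B → y ∉ B → x ≡ y ⊎ Adj G x y → Adj G x y
    adjacent-across x∈B y∉B (inj₁ refl) = ⊥-elim (y∉B x∈B)
    adjacent-across _   _   (inj₂ x~y)  = x~y

  connected-∪ : ∀ {X Y x y} → Connected G X → Connected G Y → x ∈ X → y ∈ Y →
                x ≡ y ⊎ Adj G x y → Connected G (X ∪ Y)
  connected-∪ {X} {Y} {x} {y} X-conn Y-conn x∈X y∈Y x≈y B B⊆ (a , a∈B) (b , b∈ , b∉B)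
    with connected-split X-conn B | connected-split Y-conn B
  ... | inj₁ cr | _ = crossing-⊆ (p⊆p∪q Y) cr
  ... | _ | inj₁ cr = crossing-⊆ (q⊆p∪q X Y) cr
  ... | inj₂ (inj₁ X⊆B) | inj₂ (inj₁ Y⊆B) = ⊥-elim (b∉B ([ X⊆B , Y⊆B ]′ (x∈p∪q⁻ X Y b∈)))
  ... | inj₂ (inj₂ X∩B≡∅) | inj₂ (inj₂ Y∩B≡∅) =
    ⊥-elim ([ X∩B≡∅ , Y∩B≡∅ ]′ (x∈p∪q⁻ X Y (B⊆ a∈B)) a∈B)
  ... | inj₂ (inj₁ X⊆B) | inj₂ (inj₂ Y∩B≡∅) =
    x , y , X⊆B x∈X , q⊆p∪q X Y y∈Y , Y∩B≡∅ y∈Y , adjacent-across (X⊆B x∈X) (Y∩B≡∅ y∈Y) x≈y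
  ... | inj₂ (inj₂ X∩B≡∅) | inj₂ (inj₁ Y⊆B) =
    y , x , Y⊆B y∈Y , p⊆p∪q Y x∈X , X∩B≡∅ x∈X ,
    adjacent-across (Y⊆B y∈Y) (X∩B≡∅ x∈X) (Data.Sum.map ≡.sym (Graph.sym G) x≈y)

  connected-star : ∀ y Z → (∀ {z} → z ∈ Z → Adj G y z) → Connected G (⁅ y ⁆ ∪ Z)
  connected-star y Z y~Z B B⊆ (a , a∈B) (b , b∈ , b∉B) with y ∈? B
  ... | yes y∈B = y , b , y∈B , b∈ , b∉B , y~Z (∈⁅y⁆∪q⇒∈q {q = Z} b∈ λ { refl → b∉B y∈B })
  ... | no y∉B = a , y , a∈B , p⊆p∪q Z (x∈⁅x⁆ y) , y∉B ,
                 Graph.sym G (y~Z (∈⁅y⁆∪q⇒∈q {q = Z} (B⊆ a∈B) λ { refl → y∉B a∈B }))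

-- Polymers, components and the partition function

module _ {n : ℕ} (G : Graph n) (I : Subset n) where

  ⟨_⟩ : Subset n → Subset n
  ⟨ S ⟩ = S ∪ N₂ G S I

  ∈N₂⁻ : ∀ {S v} → v ∈ N₂ G S I → v ∈ I × ∃ λ x → x ∈ S × Adj G x v
  ∈N₂⁻ {S} v∈ = p∩q⊆q (N G S) I v∈ , proj₂ (∈N⁻ G (p∩q⊆p (N G S) I v∈))

  ∈N₂⁺ : ∀ {S v x} → S ⊆ ∁ I → v ∈ I → x ∈ S → Adj G x v → v ∈ N₂ G S I
  ∈N₂⁺ S⊆Ī v∈I x∈S x~v = x∈p∩q⁺ (∈N⁺ G (λ v∈S → x∈∁p⇒x∉p (S⊆Ī v∈S) v∈I) x∈S x~v , v∈I)

  ∈⟨⟩⇒∈ : ∀ {S x} → x ∉ I → x ∈ ⟨ S ⟩ → x ∈ S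
  ∈⟨⟩⇒∈ {S} x∉I x∈ = [ (λ x∈S → x∈S) , (λ x∈N → ⊥-elim (x∉I (proj₁ (∈N₂⁻ x∈N)))) ]′ (x∈p∪q⁻ S _ x∈)

  N₂-∪ : ∀ {S T} → S ⊆ ∁ I → T ⊆ ∁ I → N₂ G (S ∪ T) I ≡ N₂ G S I ∪ N₂ G T I
  N₂-∪ {S} {T} S⊆Ī T⊆Ī = ⊆-antisym split (∪-⊆ (mono (p⊆p∪q T)) (mono (q⊆p∪q S T)))
    where
    split : N₂ G (S ∪ T) I ⊆ N₂ G S I ∪ N₂ G T I
    split v∈ with ∈N₂⁻ v∈
    ... | v∈I , x , x∈S∪T , x~v = x∈p∪q⁺ (Data.Sum.map
      (λ x∈S → ∈N₂⁺ S⊆Ī v∈I x∈S x~v) (λ x∈T → ∈N₂⁺ T⊆Ī v∈I x∈T x~v) (x∈p∪q⁻ S T x∈S∪T))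
    mono : ∀ {X} → X ⊆ S ∪ T → N₂ G X I ⊆ N₂ G (S ∪ T) I
    mono X⊆S∪T v∈ with ∈N₂⁻ v∈
    ... | v∈I , x , x∈X , x~v = ∈N₂⁺ (∪-⊆ S⊆Ī T⊆Ī) v∈I (X⊆S∪T x∈X) x~v

  ⟨⟩-∪ : ∀ {S T} → S ⊆ ∁ I → T ⊆ ∁ I → ⟨ S ∪ T ⟩ ≡ ⟨ S ⟩ ∪ ⟨ T ⟩
  ⟨⟩-∪ {S} {T} S⊆Ī T⊆Ī = trans (cong ((S ∪ T) ∪_) (N₂-∪ S⊆Ī T⊆Ī))
    (interchange (CommutativeMonoid.commutativeSemigroup (∪-commutativeMonoid n)) S T _ _)

  linked-∪ : ∀ {S T x y} → S ⊆ ∁ I → T ⊆ ∁ I → Linked G I S → Linked G I T →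
             x ∈ ⟨ S ⟩ → y ∈ ⟨ T ⟩ → x ≡ y ⊎ Adj G x y → Linked G I (S ∪ T)
  linked-∪ S⊆Ī T⊆Ī S-linked T-linked x∈ y∈ x≈y =
    subst (Connected G) (≡.sym (⟨⟩-∪ S⊆Ī T⊆Ī)) (connected-∪ G S-linked T-linked x∈ y∈ x≈y)

  linked-∪-commonNeighbour : ∀ {S T z} → Polymer G I S → Polymer G I T →
                             z ∈ N₂ G S I → z ∈ N₂ G T I → Linked G I (S ∪ T)
  linked-∪-commonNeighbour {S} {T} (S⊆Ī , _ , _ , S-linked) (T⊆Ī , _ , _ , T-linked) z∈NS z∈NT =
    linked-∪ S⊆Ī T⊆Ī S-linked T-linked (q⊆p∪q S _ z∈NS) (q⊆p∪q T _ z∈NT) (inj₁ refl)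

  polymer-⁅⁆ : ∀ {y} → y ∉ I → Polymer G I ⁅ y ⁆
  polymer-⁅⁆ {y} y∉I = x∈p⇒⁅x⁆⊆p (x∉p⇒x∈∁p y∉I) , (y , x∈⁅x⁆ y) , ⁅y⁆-independent ,
    connected-star G y _ y~N
    where
    y~N : ∀ {z} → z ∈ N₂ G ⁅ y ⁆ I → Adj G y z
    y~N z∈N with ∈N₂⁻ z∈N
    ... | _ , x , x∈⁅y⁆ , x~z with x∈⁅y⁆⇒x≡y y x∈⁅y⁆
    ...   | refl = x~z
    ⁅y⁆-independent : Independent G ⁅ y ⁆
    ⁅y⁆-independent x z x∈ z∈ x~z with x∈⁅y⁆⇒x≡y y x∈ | x∈⁅y⁆⇒x≡y y z∈
    ... | refl | refl = Graph.irrefl G x~z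

  -- The two ways in which adding y to S keeps it (2,I)-linked.
  Touches : Subset n → Fin n → Set
  Touches S y = (∃ λ x → x ∈ S × Adj G x y)
              ⊎ (∃ λ x → ∃ λ z → x ∈ S × z ∈ I × Adj G x z × Adj G y z)

  touches? : ∀ S y → Dec (Touches S y)
  touches? S y =
    any? (λ x → (x ∈? S) ×-dec adj? G x y) ⊎-dec
    any? (λ x → any? (λ z → (x ∈? S) ×-dec ((z ∈? I) ×-dec (adj? G x z ×-dec adj? G y z))))

  polymer-∪⁅⁆ : ∀ {A S y} → IndependentIn G (∁ I) A → Polymer G I S → S ⊆ A → y ∈ A → Touches S y →
                Polymer G I (S ∪ ⁅ y ⁆)
  polymer-∪⁅⁆ {A} {S} {y} (A⊆Ī , A-indep) S-polymer@(S⊆Ī , (v , v∈S) , _ , S-linked)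
              S⊆A y∈A y-touches =
    ∪-⊆ S⊆Ī ⁅y⁆⊆Ī , (v , p⊆p∪q ⁅ y ⁆ v∈S) , independent-⊆ G (∪-⊆ S⊆A (x∈p⇒⁅x⁆⊆p y∈A)) A-indep ,
    linked y-touches
    where
    ⁅y⁆-polymer : Polymer G I ⁅ y ⁆
    ⁅y⁆-polymer = polymer-⁅⁆ (x∈∁p⇒x∉p (A⊆Ī y∈A))
    ⁅y⁆⊆Ī : ⁅ y ⁆ ⊆ ∁ I
    ⁅y⁆⊆Ī = proj₁ ⁅y⁆-polymer
    linked : Touches S y → Linked G I (S ∪ ⁅ y ⁆)
    linked (inj₁ (x , x∈S , x~y)) = linked-∪ S⊆Ī ⁅y⁆⊆Ī S-linked (proj₂ (proj₂ (proj₂ ⁅y⁆-polymer)))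
      (p⊆p∪q _ x∈S) (p⊆p∪q _ (x∈⁅x⁆ y)) (inj₂ x~y)
    linked (inj₂ (x , z , x∈S , z∈I , x~z , y~z)) = linked-∪-commonNeighbour
      S-polymer ⁅y⁆-polymer (∈N₂⁺ S⊆Ī z∈I x∈S x~z) (∈N₂⁺ ⁅y⁆⊆Ī z∈I (x∈⁅x⁆ y) y~z)

  N₂-⊥ : N₂ G ⊥ I ≡ ⊥
  N₂-⊥ = Empty-unique λ (_ , v∈) → ∉⊥ (proj₁ (proj₂ (proj₂ (∈N₂⁻ v∈))))

  compatible-sym : Symmetric (Compatible G I)
  compatible-sym {S} {T} = subst (λ X → Independent G X × ¬ Linked G I X) (∪-comm S T)

  prodℚ-weight : ∀ {Ss} → All (Polymer G I) Ss → AllPairs (Compatible G I) Ss →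
                 prodℚ (map (weight G I) Ss) ≡ halfPow ∣ N₂ G (⋃ Ss) I ∣
  prodℚ-weight [] [] = cong halfPow (≡.sym (trans (cong ∣_∣ N₂-⊥) (∣⊥∣≡0 n)))
  prodℚ-weight {S ∷ Ss} (S-polymer ∷ Ss-polymers) (S-compatible ∷ Ss-compatible) = begin
    weight G I S * prodℚ (map (weight G I) Ss)
      ≡⟨ cong (weight G I S *_) (prodℚ-weight Ss-polymers Ss-compatible) ⟩
    halfPow ∣ N₂ G S I ∣ * halfPow ∣ N₂ G (⋃ Ss) I ∣
      ≡⟨ halfPow-+ ∣ N₂ G S I ∣ ∣ N₂ G (⋃ Ss) I ∣ ⟨
    halfPow (∣ N₂ G S I ∣ ℕ.+ ∣ N₂ G (⋃ Ss) I ∣)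
      ≡⟨ cong halfPow (∣p∪q∣≡∣p∣+∣q∣ _ _ disjoint) ⟨
    halfPow ∣ N₂ G S I ∪ N₂ G (⋃ Ss) I ∣
      ≡⟨ cong (halfPow ∘ ∣_∣) (N₂-∪ (proj₁ S-polymer) ⋃Ss⊆Ī) ⟨
    halfPow ∣ N₂ G (S ∪ ⋃ Ss) I ∣  ∎
    where
    open ≡.≡-Reasoning
    ⋃Ss⊆Ī : ⋃ Ss ⊆ ∁ I
    ⋃Ss⊆Ī = ⋃-⊆ Ss (λ T∈ → proj₁ (All.lookup Ss-polymers T∈))
    disjoint : ∀ {z} → z ∈ N₂ G S I → z ∉ N₂ G (⋃ Ss) I
    disjoint z∈NS z∈N⋃ with ∈N₂⁻ z∈N⋃
    ... | z∈I , y , y∈⋃ , y~z with ∈⋃⁻ Ss y∈⋃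
    ...   | T , T∈ , y∈T = proj₂ (All.lookup S-compatible T∈)
            (linked-∪-commonNeighbour S-polymer T-polymer z∈NS (∈N₂⁺ (proj₁ T-polymer) z∈I y∈T y~z))
      where
      T-polymer : Polymer G I T
      T-polymer = All.lookup Ss-polymers T∈

  Component : Subset n → Subset n → Set
  Component A S = Polymer G I S × S ⊆ A × (∀ y → y ∈ A → y ∉ S → ¬ Touches S y)

  component? : ∀ A S → Dec (Component A S)
  component? A S = polymer? G I S ×-dec ((S ⊆? A) ×-dec
    all? (λ y → (y ∈? A) →-dec (¬? (y ∈? S) →-dec ¬? (touches? S y))))

  -- A polymer through v inside A of maximal size cannot be enlarged, so it is a component.
  component-exists : ∀ {A v} → IndependentIn G (∁ I) A → v ∈ A → ∃ λ S → Component A S × v ∈ S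
  component-exists {A} {v} A-indep@(A⊆Ī , _) v∈A = S , (S-polymer , S⊆A , isolated) , v∈S
    where
    Candidate : Subset n → Set
    Candidate S = Polymer G I S × S ⊆ A × v ∈ S
    candidate? : ∀ S → Dec (Candidate S)
    candidate? S = polymer? G I S ×-dec ((S ⊆? A) ×-dec (v ∈? S))
    candidates : List (Subset n)
    candidates = filter candidate? (allSubsets n)
    S : Subset n
    S = argmax ∣_∣ ⁅ v ⁆ candidates
    S-candidate : Candidate S
    S-candidate = argmax-all ∣_∣
      (polymer-⁅⁆ (x∈∁p⇒x∉p (A⊆Ī v∈A)) , (λ {_} → x∈p⇒⁅x⁆⊆p v∈A) , x∈⁅x⁆ v)
      (all-filter candidate? (allSubsets n))
    S-polymer : Polymer G I S
    S-polymer = proj₁ S-candidate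
    S⊆A : S ⊆ A
    S⊆A = proj₁ (proj₂ S-candidate)
    v∈S : v ∈ S
    v∈S = proj₂ (proj₂ S-candidate)
    maximal : ∀ {T} → Candidate T → ∣ T ∣ ℕ.≤ ∣ S ∣
    maximal {T} T-candidate = All.lookup (f[xs]≤f[argmax] ⁅ v ⁆ candidates)
      (∈-filter⁺ candidate? (∈-allSubsets T) T-candidate)
    isolated : ∀ y → y ∈ A → y ∉ S → ¬ Touches S y
    isolated y y∈A y∉S y-touches =
      ℕₚ.<⇒≱ (p⊂q⇒∣p∣<∣q∣ (p⊆p∪q ⁅ y ⁆ , y , q⊆p∪q S ⁅ y ⁆ (x∈⁅x⁆ y) , y∉S))
             (maximal (polymer-∪⁅⁆ A-indep S-polymer S⊆A y∈A y-touches ,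
                       ∪-⊆ S⊆A (x∈p⇒⁅x⁆⊆p y∈A) , p⊆p∪q ⁅ y ⁆ v∈S))

  components : Subset n → List (Subset n)
  components A = filter (component? A) (polymers G I)

  ∈-components⁻ : ∀ {A S} → S ∈ₗ components A → Component A S
  ∈-components⁻ {A} S∈ = proj₂ (∈-filter⁻ (component? A) {xs = polymers G I} S∈)

  polymers-unique : Unique (polymers G I)
  polymers-unique = Uniqueₚ.filter⁺ (polymer? G I) (allSubsets-unique n)

  ∈-polymers⁺ : ∀ {S} → Polymer G I S → S ∈ₗ polymers G I
  ∈-polymers⁺ {S} = ∈-filter⁺ (polymer? G I) (∈-allSubsets S)

  ∈-sublists-polymers⁻ : ∀ {Ss} → Ss ∈ₗ sublists (polymers G I) → All (Polymer G I) Ss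
  ∈-sublists-polymers⁻ Ss∈ = All.tabulate λ S∈ →
    proj₂ (∈-filter⁻ (polymer? G I) {xs = allSubsets n} (∈-sublists⁻ Ss∈ S∈))

  ∈-compatibleFamilies⁻ : ∀ {Ss} → Ss ∈ₗ compatibleFamilies G I →
                          Ss ∈ₗ sublists (polymers G I) × AllPairs (Compatible G I) Ss
  ∈-compatibleFamilies⁻ = ∈-filter⁻ (allPairs? (compatible? G I)) {xs = sublists (polymers G I)}

  module _ {Ss : List (Subset n)} (Ss-polymers : All (Polymer G I) Ss)
           (Ss-compatible : AllPairs (Compatible G I) Ss) where

    private
      equal-or-compatible : ∀ {S T} → S ∈ₗ Ss → T ∈ₗ Ss → S ≡ T ⊎ Compatible G I S T
      equal-or-compatible = AllPairs-∈ compatible-sym Ss-compatible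

    ⋃-independentIn : IndependentIn G (∁ I) (⋃ Ss)
    ⋃-independentIn = ⋃-⊆ Ss (λ S∈ → proj₁ (All.lookup Ss-polymers S∈)) , ⋃-independent
      where
      ⋃-independent : Independent G (⋃ Ss)
      ⋃-independent x y x∈ y∈ with ∈⋃⁻ Ss x∈ | ∈⋃⁻ Ss y∈
      ... | S , S∈ , x∈S | T , T∈ , y∈T with equal-or-compatible S∈ T∈
      ...   | inj₁ refl = proj₁ (proj₂ (proj₂ (All.lookup Ss-polymers S∈))) x y x∈S y∈T
      ...   | inj₂ (S∪T-indep , _) = S∪T-indep x y (p⊆p∪q T x∈S) (q⊆p∪q S T y∈T)

    ∈⇒component : ∀ {S} → S ∈ₗ Ss → Component (⋃ Ss) S
    ∈⇒component {S} S∈ = S-polymer , ∈⋃⁺ S∈ , isolated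
      where
      S-polymer : Polymer G I S
      S-polymer = All.lookup Ss-polymers S∈
      isolated : ∀ y → y ∈ ⋃ Ss → y ∉ S → ¬ Touches S y
      isolated y y∈ y∉S y-touches with ∈⋃⁻ Ss y∈
      ... | T , T∈ , y∈T with equal-or-compatible S∈ T∈ | y-touches
      ...   | inj₁ refl | _ = y∉S y∈T
      ...   | inj₂ (S∪T-indep , _) | inj₁ (x , x∈S , x~y) =
              S∪T-indep x y (p⊆p∪q T x∈S) (q⊆p∪q S T y∈T) x~y
      ...   | inj₂ (_ , S∪T-unlinked) | inj₂ (x , z , x∈S , z∈I , x~z , y~z) =
              S∪T-unlinked (linked-∪-commonNeighbour S-polymer T-polymer
                (∈N₂⁺ (proj₁ S-polymer) z∈I x∈S x~z) (∈N₂⁺ (proj₁ T-polymer) z∈I y∈T y~z))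
        where
        T-polymer : Polymer G I T
        T-polymer = All.lookup Ss-polymers T∈

  independentOutside : List (Subset n)
  independentOutside = filter (independentIn? G (∁ I)) (allSubsets n)

  module _ (I-indep : Independent G I) where

    component-isolated : ∀ {A S T} → Component A T → S ⊆ A → ¬ Crossing G ⟨ T ⟩ ⟨ S ⟩
    component-isolated {A} {S} {T} ((T⊆Ī , _) , _ , T-isolated) S⊆A
                       (a , b , a∈⟨T⟩ , b∈⟨S⟩ , b∉⟨T⟩ , a~b)
      with x∈p∪q⁻ T _ a∈⟨T⟩ | x∈p∪q⁻ S _ b∈⟨S⟩
    ... | inj₁ a∈T | inj₁ b∈S =
      T-isolated b (S⊆A b∈S) (λ b∈T → b∉⟨T⟩ (p⊆p∪q _ b∈T)) (inj₁ (a , a∈T , a~b))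
    ... | inj₁ a∈T | inj₂ b∈N = b∉⟨T⟩ (q⊆p∪q T _ (∈N₂⁺ T⊆Ī (proj₁ (∈N₂⁻ b∈N)) a∈T a~b))
    ... | inj₂ a∈N | inj₁ b∈S with ∈N₂⁻ a∈N
    ...   | a∈I , t , t∈T , t~a = T-isolated b (S⊆A b∈S) (λ b∈T → b∉⟨T⟩ (p⊆p∪q _ b∈T))
              (inj₂ (t , a , t∈T , a∈I , t~a , Graph.sym G a~b))
    component-isolated _ _ (a , b , _ , _ , _ , a~b) | inj₂ a∈N | inj₂ b∈N =
      I-indep a b (proj₁ (∈N₂⁻ a∈N)) (proj₁ (∈N₂⁻ b∈N)) a~b

    component-⊆ : ∀ {A S T v} → Component A S → Component A T → v ∈ S → v ∈ T → S ⊆ T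
    component-⊆ ((S⊆Ī , _ , _ , S-linked) , S⊆A , _) T-component v∈S v∈T {x} x∈S
      with connected-split G S-linked ⟨ _ ⟩
    ... | inj₁ crossing        = ⊥-elim (component-isolated T-component S⊆A crossing)
    ... | inj₂ (inj₁ ⟨S⟩⊆⟨T⟩)  = ∈⟨⟩⇒∈ (x∈∁p⇒x∉p (S⊆Ī x∈S)) (⟨S⟩⊆⟨T⟩ (p⊆p∪q _ x∈S))
    ... | inj₂ (inj₂ disjoint) = ⊥-elim (disjoint (p⊆p∪q _ v∈S) (p⊆p∪q _ v∈T))

    component-unique : ∀ {A S T v} → Component A S → Component A T → v ∈ S → v ∈ T → S ≡ T
    component-unique S-component T-component v∈S v∈T =
      ⊆-antisym (component-⊆ S-component T-component v∈S v∈T)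
                (component-⊆ T-component S-component v∈T v∈S)

    components-compatible : ∀ {A S T} → IndependentIn G (∁ I) A → Component A S → Component A T →
                            S ≢ T → Compatible G I S T
    components-compatible {A} {S} {T} (_ , A-indep)
      S-component@((S⊆Ī , (v , v∈S) , _) , S⊆A , _)
      T-component@((T⊆Ī , (t , t∈T) , _) , T⊆A , _) S≢T =
      independent-⊆ G (∪-⊆ S⊆A T⊆A) A-indep , unlinked
      where
      unlinked : ¬ Linked G I (S ∪ T)
      unlinked S∪T-linked
        with connected-split G (subst (Connected G) (⟨⟩-∪ S⊆Ī T⊆Ī) S∪T-linked) ⟨ S ⟩
      ... | inj₁ (a , b , a∈ , b∈ , b∉ , a~b) = component-isolated S-component T⊆A
        (a , b , a∈ , [ ⊥-elim ∘ b∉ , id ]′ (x∈p∪q⁻ ⟨ S ⟩ ⟨ T ⟩ b∈) , b∉ , a~b)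
      ... | inj₂ (inj₁ ⊆⟨S⟩) = S≢T (component-unique S-component T-component
        (∈⟨⟩⇒∈ (x∈∁p⇒x∉p (T⊆Ī t∈T)) (⊆⟨S⟩ (q⊆p∪q ⟨ S ⟩ ⟨ T ⟩ (p⊆p∪q _ t∈T)))) t∈T)
      ... | inj₂ (inj₂ disjoint) = disjoint (p⊆p∪q ⟨ T ⟩ (p⊆p∪q _ v∈S)) (p⊆p∪q _ v∈S)

    component⇒∈ : ∀ {Ss S} → All (Polymer G I) Ss → AllPairs (Compatible G I) Ss →
                  Component (⋃ Ss) S → S ∈ₗ Ss
    component⇒∈ {Ss} Ss-polymers Ss-compatible S-component@((_ , (v , v∈S) , _) , S⊆⋃ , _)
      with ∈⋃⁻ Ss (S⊆⋃ v∈S)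
    ... | T , T∈ , v∈T = subst (_∈ₗ Ss)
      (≡.sym (component-unique S-component (∈⇒component Ss-polymers Ss-compatible T∈) v∈S v∈T)) T∈

    ≡components-⋃ : ∀ {Ss} → Ss ∈ₗ compatibleFamilies G I → Ss ≡ components (⋃ Ss)
    ≡components-⋃ {Ss} Ss∈ with ∈-compatibleFamilies⁻ Ss∈
    ... | Ss∈sublists , Ss-compatible =
      ∈-sublists⇒≡filter (component? (⋃ Ss)) polymers-unique Ss∈sublists
        (λ _ → ∈⇒component Ss-polymers Ss-compatible) (λ _ → component⇒∈ Ss-polymers Ss-compatible)
      where
      Ss-polymers : All (Polymer G I) Ss
      Ss-polymers = ∈-sublists-polymers⁻ Ss∈sublists

    components∈compatibleFamilies : ∀ {A} → IndependentIn G (∁ I) A →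
                                    components A ∈ₗ compatibleFamilies G I
    components∈compatibleFamilies {A} A-indep =
      ∈-filter⁺ (allPairs? (compatible? G I)) (filter∈sublists (component? A) (polymers G I))
        (Unique⇒AllPairs (Uniqueₚ.filter⁺ (component? A) polymers-unique)
          (λ S∈ T∈ → components-compatible A-indep (∈-components⁻ S∈) (∈-components⁻ T∈)))

    ⋃-components : ∀ {A} → IndependentIn G (∁ I) A → ⋃ (components A) ≡ A
    ⋃-components {A} A-indep =
      ⊆-antisym (⋃-⊆ (components A) (λ S∈ → proj₁ (proj₂ (∈-components⁻ S∈)))) A⊆⋃
      where
      A⊆⋃ : A ⊆ ⋃ (components A)
      A⊆⋃ v∈A with component-exists A-indep v∈A
      ... | S , S-component , v∈S =
        ∈⋃⁺ (∈-filter⁺ (component? A) (∈-polymers⁺ (proj₁ S-component)) S-component) v∈S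

    map-⋃-compatibleFamilies : map ⋃ (compatibleFamilies G I) ↭ independentOutside
    map-⋃-compatibleFamilies = unique∧sameMembers⇒↭ ⋃-unique
      (Uniqueₚ.filter⁺ (independentIn? G (∁ I)) (allSubsets-unique n)) sound complete
      where
      ⋃-unique : Unique (map ⋃ (compatibleFamilies G I))
      ⋃-unique = AllPairsₚ.map⁺ (Unique⇒AllPairs
        (Uniqueₚ.filter⁺ (allPairs? (compatible? G I)) (sublists-unique polymers-unique))
        λ Ss∈ Ts∈ Ss≢Ts ⋃Ss≡⋃Ts → Ss≢Ts (trans (≡components-⋃ Ss∈)
          (trans (cong components ⋃Ss≡⋃Ts) (≡.sym (≡components-⋃ Ts∈)))))
      sound : ∀ {A} → A ∈ₗ map ⋃ (compatibleFamilies G I) → A ∈ₗ independentOutside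
      sound A∈ with ∈-map⁻ ⋃ A∈
      ... | Ss , Ss∈ , refl with ∈-compatibleFamilies⁻ Ss∈
      ...   | Ss∈sublists , Ss-compatible = ∈-filter⁺ (independentIn? G (∁ I)) (∈-allSubsets _)
              (⋃-independentIn (∈-sublists-polymers⁻ Ss∈sublists) Ss-compatible)
      complete : ∀ {A} → A ∈ₗ independentOutside → A ∈ₗ map ⋃ (compatibleFamilies G I)
      complete {A} A∈ = subst (_∈ₗ map ⋃ (compatibleFamilies G I)) (⋃-components A-indep)
                               (∈-map⁺ ⋃ (components∈compatibleFamilies A-indep))
        where
        A-indep : IndependentIn G (∁ I) A
        A-indep = proj₂ (∈-filter⁻ (independentIn? G (∁ I)) {xs = allSubsets n} A∈)

    Z≡sum-halfPow : Z G I ≡ sumℚ (map (λ A → halfPow ∣ N₂ G A I ∣) independentOutside)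
    Z≡sum-halfPow = begin
      Z G I
        ≡⟨ cong sumℚ (Listₚ.map-cong-local (All.tabulate family-weight)) ⟩
      sumℚ (map (λ Ss → halfPow ∣ N₂ G (⋃ Ss) I ∣) (compatibleFamilies G I))
        ≡⟨ cong sumℚ (Listₚ.map-∘ (compatibleFamilies G I)) ⟩
      sumℚ (map (λ A → halfPow ∣ N₂ G A I ∣) (map ⋃ (compatibleFamilies G I)))
        ≡⟨ sumℚ-↭ (↭ₚ.map⁺ _ map-⋃-compatibleFamilies) ⟩
      sumℚ (map (λ A → halfPow ∣ N₂ G A I ∣) independentOutside)  ∎
      where
      open ≡.≡-Reasoning
      family-weight : ∀ {Ss} → Ss ∈ₗ compatibleFamilies G I →
                      prodℚ (map (weight G I) Ss) ≡ halfPow ∣ N₂ G (⋃ Ss) I ∣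
      family-weight Ss∈ with ∈-compatibleFamilies⁻ Ss∈
      ... | Ss∈sublists , Ss-compatible =
        prodℚ-weight (∈-sublists-polymers⁻ Ss∈sublists) Ss-compatible

  -- Counting independent sets by their part outside I

  free : Subset n → Subset n
  free A = I ∩ ∁ (N₂ G A I)

  ℕtoℚ-2^∣free∣ : ∀ A → ℕtoℚ (2 ^ ∣ free A ∣) ≡ ℕtoℚ (2 ^ ∣ I ∣) * halfPow ∣ N₂ G A I ∣
  ℕtoℚ-2^∣free∣ A = ≡.sym (trans
    (cong (λ k → ℕtoℚ (2 ^ k) * halfPow ∣ N₂ G A I ∣)
          (∣p∣≡∣p∩∁q∣+∣q∣ I (N₂ G A I) (p∩q⊆q (N G A) I)))
    (2^-+*halfPow ∣ free A ∣ ∣ N₂ G A I ∣))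

  Fibre : Subset n → Subset n → Set
  Fibre A J = Independent G J × J ∩ ∁ I ≡ A

  fibre? : ∀ A J → Dec (Fibre A J)
  fibre? A J = independent? G J ×-dec (J ∩ ∁ I ≟ₛ A)

  fibre⇒independentIn : ∀ {A J} → Fibre A J → IndependentIn G (∁ I) A
  fibre⇒independentIn {J = J} (J-indep , refl) =
    p∩q⊆q J (∁ I) , independent-⊆ G (p∩q⊆p J (∁ I)) J-indep

  ∉I⇒∉free : ∀ {A x} → x ∉ I → x ∉ free A
  ∉I⇒∉free x∉I x∈free = x∉I (p∩q⊆p I _ x∈free)

  ∈N₂⇒∉free : ∀ {A x} → x ∈ N₂ G A I → x ∉ free A
  ∈N₂⇒∉free x∈N x∈free = x∈∁p⇒x∉p (p∩q⊆q I _ x∈free) x∈N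

  fibre⇒agreeOutside : ∀ {A J} → Fibre A J → AgreeOutside (free A) J A
  fibre⇒agreeOutside {A} {J} (J-indep , J∖I≡A) = agreeOutside⁺ J⊆A (λ _ → A⊆J)
    where
    A⊆J : ∀ {x} → x ∈ A → x ∈ J
    A⊆J x∈A = p∩q⊆p J (∁ I) (subst (_ ∈_) (≡.sym J∖I≡A) x∈A)
    J⊆A : ∀ {x} → x ∉ free A → x ∈ J → x ∈ A
    J⊆A {x} x∉free x∈J with x ∈? I
    ... | no x∉I  = subst (x ∈_) J∖I≡A (x∈p∩q⁺ (x∈J , x∉p⇒x∈∁p x∉I))
    ... | yes x∈I with ∈N₂⁻ (decidable-stable (x ∈? N₂ G A I)
                               λ x∉N → x∉free (x∈p∩q⁺ (x∈I , x∉p⇒x∈∁p x∉N)))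
    ...   | _ , a , a∈A , a~x = ⊥-elim (J-indep a x (A⊆J a∈A) x∈J a~x)

  module _ (I-indep : Independent G I) where

    agreeOutside⇒fibre : ∀ {A J} → IndependentIn G (∁ I) A → AgreeOutside (free A) J A → Fibre A J
    agreeOutside⇒fibre {A} {J} (A⊆Ī , A-indep) J≈A = J-indep , ⊆-antisym J∖I⊆A A⊆J∖I
      where
      J⊆A : ∀ {x} → x ∉ I → x ∈ J → x ∈ A
      J⊆A x∉I = agreeOutside⁻ J≈A (∉I⇒∉free x∉I)
      A⊆J : ∀ {x} → x ∈ A → x ∈ J
      A⊆J x∈A = agreeOutside⁻ (≡.sym J≈A) (∉I⇒∉free (x∈∁p⇒x∉p (A⊆Ī x∈A))) x∈A
      J∖I⊆A : J ∩ ∁ I ⊆ A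
      J∖I⊆A x∈ with x∈p∩q⁻ J (∁ I) x∈
      ... | x∈J , x∈Ī = J⊆A (x∈∁p⇒x∉p x∈Ī) x∈J
      A⊆J∖I : A ⊆ J ∩ ∁ I
      A⊆J∖I x∈A = x∈p∩q⁺ (A⊆J x∈A , A⊆Ī x∈A)
      -- the end in I of such an edge lies in N(A, I), where J agrees with A
      across : ∀ {x y} → x ∈ J → y ∈ J → x ∉ I → y ∈ I → ¬ Adj G x y
      across {y = y} x∈J y∈J x∉I y∈I x~y =
        x∈∁p⇒x∉p (A⊆Ī (agreeOutside⁻ J≈A (∈N₂⇒∉free y∈N) y∈J)) y∈I
        where
        y∈N : y ∈ N₂ G A I
        y∈N = ∈N₂⁺ A⊆Ī y∈I (J⊆A x∉I x∈J) x~y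
      J-indep : Independent G J
      J-indep x y x∈J y∈J x~y with x ∈? I | y ∈? I
      ... | yes x∈I | yes y∈I = I-indep x y x∈I y∈I x~y
      ... | no x∉I  | no y∉I  = A-indep x y (J⊆A x∉I x∈J) (J⊆A y∉I y∈J) x~y
      ... | no x∉I  | yes y∈I = across x∈J y∈J x∉I y∈I x~y
      ... | yes x∈I | no y∉I  = across y∈J x∈J y∉I x∈I (Graph.sym G x~y)

    sum-𝟙-fibre : ∀ A → sum (map (λ J → 𝟙 (fibre? A J)) (allSubsets n)) ≡
                        𝟙 (independentIn? G (∁ I) A) ℕ.* 2 ^ ∣ free A ∣
    sum-𝟙-fibre A = by-cases (independentIn? G (∁ I) A)
      where
      open ≡.≡-Reasoning
      by-cases : (A-indep? : Dec (IndependentIn G (∁ I) A)) →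
                 sum (map (λ J → 𝟙 (fibre? A J)) (allSubsets n)) ≡ 𝟙 A-indep? ℕ.* 2 ^ ∣ free A ∣
      by-cases (yes A-indep) = begin
        sum (map (λ J → 𝟙 (fibre? A J)) (allSubsets n))
          ≡⟨ cong sum (Listₚ.map-cong (λ J → 𝟙-cong fibre⇔agreeOutside (fibre? A J) (agreeOutside? _ J A))
                                      (allSubsets n)) ⟩
        sum (map (λ J → 𝟙 (agreeOutside? (free A) J A)) (allSubsets n))
          ≡⟨ count-agreeOutside (free A) A ⟩
        2 ^ ∣ free A ∣
          ≡⟨ ℕₚ.*-identityˡ _ ⟨
        1 ℕ.* 2 ^ ∣ free A ∣  ∎
        where
        fibre⇔agreeOutside : ∀ {J} → Fibre A J ⇔ AgreeOutside (free A) J A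
        fibre⇔agreeOutside = mk⇔ fibre⇒agreeOutside (agreeOutside⇒fibre A-indep)
      by-cases (no ¬A-indep) = sum-map-zero (All.universal
        (λ J → 𝟙-no (¬A-indep ∘ fibre⇒independentIn) (fibre? A J)) (allSubsets n))

    𝟙-independent≡sum-𝟙-fibre : ∀ J → 𝟙 (independent? G J) ≡
                                      sum (map (λ A → 𝟙 (fibre? A J)) (allSubsets n))
    𝟙-independent≡sum-𝟙-fibre J = ≡.sym (begin
      sum (map (λ A → 𝟙 (fibre? A J)) (allSubsets n))
        ≡⟨ cong sum (Listₚ.map-cong (λ A → 𝟙-× (independent? G J) (J ∩ ∁ I ≟ₛ A)) (allSubsets n)) ⟩
      sum (map (λ A → 𝟙 (independent? G J) ℕ.* 𝟙 (J ∩ ∁ I ≟ₛ A)) (allSubsets n))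
        ≡⟨ sum-map-*ˡ (𝟙 (independent? G J)) _ (allSubsets n) ⟩
      𝟙 (independent? G J) ℕ.* sum (map (λ A → 𝟙 (J ∩ ∁ I ≟ₛ A)) (allSubsets n))
        ≡⟨ cong (𝟙 (independent? G J) ℕ.*_)
                (sum-𝟙-≟ _≟ₛ_ (allSubsets-unique n) (∈-allSubsets (J ∩ ∁ I))) ⟩
      𝟙 (independent? G J) ℕ.* 1
        ≡⟨ ℕₚ.*-identityʳ _ ⟩
      𝟙 (independent? G J)  ∎)
      where open ≡.≡-Reasoning

    -- Double counting the pairs (A, J) with J independent and J ∖ I = A.
    numIndependentSets≡ : numIndependentSets G ≡ sum (map (λ A → 2 ^ ∣ free A ∣) independentOutside)
    numIndependentSets≡ = begin
      length (filter (independent? G) (allSubsets n))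
        ≡⟨ length-filter (independent? G) (allSubsets n) ⟩
      sum (map (𝟙 ∘ independent? G) (allSubsets n))
        ≡⟨ cong sum (Listₚ.map-cong 𝟙-independent≡sum-𝟙-fibre (allSubsets n)) ⟩
      sum (map (λ J → sum (map (λ A → 𝟙 (fibre? A J)) (allSubsets n))) (allSubsets n))
        ≡⟨ sum-map-swap (λ J A → 𝟙 (fibre? A J)) (allSubsets n) (allSubsets n) ⟩
      sum (map (λ A → sum (map (λ J → 𝟙 (fibre? A J)) (allSubsets n))) (allSubsets n))
        ≡⟨ cong sum (Listₚ.map-cong sum-𝟙-fibre (allSubsets n)) ⟩
      sum (map (λ A → 𝟙 (independentIn? G (∁ I) A) ℕ.* 2 ^ ∣ free A ∣) (allSubsets n))
        ≡⟨ sum-map-filter (independentIn? G (∁ I)) (λ A → 2 ^ ∣ free A ∣) (allSubsets n) ⟨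
      sum (map (λ A → 2 ^ ∣ free A ∣) independentOutside)  ∎
      where open ≡.≡-Reasoning

lemma4p1 : (n : ℕ) (G : Graph n) (I : Subset n) → Independent G I →
           ℕtoℚ (numIndependentSets G) ≡ ℕtoℚ (2 ^ ∣ I ∣) * Z G I
lemma4p1 n G I I-indep = begin
  ℕtoℚ (numIndependentSets G)
    ≡⟨ cong ℕtoℚ (numIndependentSets≡ G I I-indep) ⟩
  ℕtoℚ (sum (map (λ A → 2 ^ ∣ free G I A ∣) V))
    ≡⟨ ℕtoℚ-sum _ V ⟩
  sumℚ (map (λ A → ℕtoℚ (2 ^ ∣ free G I A ∣)) V)
    ≡⟨ cong sumℚ (Listₚ.map-cong (ℕtoℚ-2^∣free∣ G I) V) ⟩
  sumℚ (map (λ A → ℕtoℚ (2 ^ ∣ I ∣) * halfPow ∣ N₂ G A I ∣) V)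
    ≡⟨ *-sumℚ (ℕtoℚ (2 ^ ∣ I ∣)) _ V ⟨
  ℕtoℚ (2 ^ ∣ I ∣) * sumℚ (map (λ A → halfPow ∣ N₂ G A I ∣) V)
    ≡⟨ cong (ℕtoℚ (2 ^ ∣ I ∣) *_) (Z≡sum-halfPow G I I-indep) ⟨
  ℕtoℚ (2 ^ ∣ I ∣) * Z G I  ∎
  where
  open ≡.≡-Reasoning
  V : List (Subset n)
  V = independentOutside G I
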